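{- Let $h,\ell>1$ and let $X\subseteq V(\Gamma_{h,\ell})$ with $|X|\leq h+1$. If $\Gamma_{h,\ell}\setminus X$ has two distinct good components, then it has at most one further component, and this component has exactly one vertex.
   Context: $\Gamma_{h,\ell}$ is the $h\times\ell$ grid with vertices $(i,j)$, $i\in[h]$ (rows), $j\in[\ell]$ (columns), and $(i,j)(i',j')$ an edge iff $|i-i'|+|j-j'|=1$. A connected component of $\Gamma_{h,\ell}\setminus X$ is good if it contains all vertices of at least one column $\{(1,j),\dots,(h,j)\}$. -}

module Defs where

open import Data.Nat using (ℕ; _+_; ∣_-_∣)
open import Data.Fin using (Fin; toℕ)
open import Data.Bool using (Bool; true; false; if_then_else_)
open import Data.List using (List; allFin; cartesianProduct; map)
open import Data.Nat.ListAction using (sum)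
open import Data.Product using (_×_; _,_; proj₁; proj₂; ∃)
open import Relation.Binary.PropositionalEquality using (_≡_)
open import Relation.Binary.Construct.Closure.ReflexiveTransitive using (Star)

-- Vertices of the h × ℓ grid Γ_{h,ℓ}: (row i, column j), 0-indexed.
Vertex : ℕ → ℕ → Set
Vertex h ℓ = Fin h × Fin ℓ

Adj : ∀ {h ℓ} → Vertex h ℓ → Vertex h ℓ → Set
Adj (i , j) (i' , j') = ∣ toℕ i - toℕ i' ∣ + ∣ toℕ j - toℕ j' ∣ ≡ 1

VSet : ℕ → ℕ → Set
VSet h ℓ = Vertex h ℓ → Bool

allVertices : (h ℓ : ℕ) → List (Vertex h ℓ)
allVertices h ℓ = cartesianProduct (allFin h) (allFin ℓ)

card : ∀ {h ℓ} → VSet h ℓ → ℕ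
card {h} {ℓ} X = sum (map (λ v → if X v then 1 else 0) (allVertices h ℓ))

NotIn : ∀ {h ℓ} → VSet h ℓ → Vertex h ℓ → Set
NotIn X v = X v ≡ false

Step : ∀ {h ℓ} → VSet h ℓ → Vertex h ℓ → Vertex h ℓ → Set
Step X u v = NotIn X u × NotIn X v × Adj u v

Connected : ∀ {h ℓ} → VSet h ℓ → Vertex h ℓ → Vertex h ℓ → Set
Connected X u v = NotIn X u × NotIn X v × Star (Step X) u v

GoodComponentOf : ∀ {h ℓ} → VSet h ℓ → Vertex h ℓ → Set
GoodComponentOf {h} {ℓ} X u = ∃ λ (j : Fin ℓ) → ∀ (i : Fin h) → Connected X u (i , j)

-- Let the good components of u and v contain the columns a and b.  Since u and v are
-- not connected, every row meets X strictly between a and b, so every row contains a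
-- vertex of X, and as |X| ≤ h + 1 at most one row contains two.  A vertex w outside
-- X, X-separated from both u and v, needs X-vertices on its row between w and a,
-- between w and b, and between a and b; no single column lies strictly between all
-- three pairs, so the row of w contains two vertices of X.  Hence all such w lie on
-- one row r.  On a neighbouring row, the vertex below such a w is again separated
-- from u and v unless it lies in X; so it lies in X, and two such w would give that
-- row two vertices of X as well.
module Submission where

open import Defs
open import Data.Nat using (ℕ; _≤_; _+_)
open import Data.Product using (_×_)
open import Relation.Binary.PropositionalEquality using (_≡_)
open import Relation.Nullary using (¬_)

open import Data.Empty using (⊥)
open import Data.Bool using (true; false; if_then_else_)
import Data.Bool.Properties as Bool
open import Data.Fin using (Fin; zero; suc; toℕ; fromℕ<; inject₁)
import Data.Fin.Properties as Fin
open import Data.List using (List; []; _∷_; map; tabulate; _++_; cartesianProduct; allFin)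
open import Data.List.Properties using (map-++; map-∘; map-tabulate; tabulate-cong)
open import Data.Nat using (zero; suc; pred; _∸_; _<_; s≤s; ∣_-_∣; _≤?_)
open import Data.Nat.ListAction using (sum)
open import Data.Nat.ListAction.Properties using (sum-++)
open import Data.Nat.Properties
open import Algebra.Properties.CommutativeSemigroup +-commutativeSemigroup using (x∙yz≈y∙xz)
open import Data.Product using (∃; _,_)
open import Data.Sum using (_⊎_; inj₁; inj₂)
open import Function using (_∘_)
open import Relation.Binary.PropositionalEquality
  using (_≢_; refl; sym; trans; cong; cong₂; subst; module ≡-Reasoning)
open import Relation.Binary.Construct.Closure.ReflexiveTransitive using (Star; ε; _◅_; _◅◅_; reverse)
open import Relation.Nullary using (Dec; yes; no; contradiction)
open import Relation.Nullary.Decidable using (_×-dec_; _⊎-dec_)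

lookup≤sum-tabulate : ∀ {n} (f : Fin n → ℕ) k → f k ≤ sum (tabulate f)
lookup≤sum-tabulate f zero    = m≤m+n _ _
lookup≤sum-tabulate f (suc k) = ≤-trans (lookup≤sum-tabulate (f ∘ suc) k) (m≤n+m _ _)

lookup+lookup≤sum-tabulate : ∀ {n} (f : Fin n → ℕ) {k k'} → k ≢ k' →
  f k + f k' ≤ sum (tabulate f)
lookup+lookup≤sum-tabulate f {zero}  {zero}   k≢k' = contradiction refl k≢k'
lookup+lookup≤sum-tabulate f {zero}  {suc k'} _    = +-monoʳ-≤ (f zero) (lookup≤sum-tabulate (f ∘ suc) k')
lookup+lookup≤sum-tabulate f {suc k} {zero}   _    =
  ≤-trans (≤-reflexive (+-comm (f (suc k)) (f zero)))
          (+-monoʳ-≤ (f zero) (lookup≤sum-tabulate (f ∘ suc) k))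
lookup+lookup≤sum-tabulate f {suc k} {suc k'} k≢k' =
  ≤-trans (lookup+lookup≤sum-tabulate (f ∘ suc) (k≢k' ∘ cong suc)) (m≤n+m _ _)

sum-tabulate≡n+sum-tabulate-pred : ∀ {n} (f : Fin n → ℕ) → (∀ i → 1 ≤ f i) →
  sum (tabulate f) ≡ n + sum (tabulate (pred ∘ f))
sum-tabulate≡n+sum-tabulate-pred {zero}  f _   = refl
sum-tabulate≡n+sum-tabulate-pred {suc n} f 1≤f = begin
  f zero + sum (tabulate (f ∘ suc))
    ≡⟨ cong₂ _+_ (sym (m+[n∸m]≡n (1≤f zero)))
                 (sum-tabulate≡n+sum-tabulate-pred (f ∘ suc) (1≤f ∘ suc)) ⟩
  suc (pred (f zero) + (n + sum (tabulate (pred ∘ f ∘ suc))))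
    ≡⟨ cong suc (x∙yz≈y∙xz (pred (f zero)) n _) ⟩
  suc n + sum (tabulate (pred ∘ f)) ∎
  where open ≡-Reasoning

-- The excess over 1 of the two large entries already exceeds the budget of 1.
≥2-unique : ∀ {n} (f : Fin n → ℕ) → (∀ i → 1 ≤ f i) → sum (tabulate f) ≤ n + 1 →
  ∀ {k k'} → 2 ≤ f k → 2 ≤ f k' → k ≡ k'
≥2-unique {n} f 1≤f bound {k} {k'} 2≤fk 2≤fk' with k Fin.≟ k'
... | yes k≡k' = k≡k'
... | no k≢k' = contradiction (≤-trans n+2≤sum bound) (<⇒≱ (+-monoʳ-< n ≤-refl))
  where
  n+2≤sum : n + 2 ≤ sum (tabulate f)
  n+2≤sum = begin
    n + 2                               ≤⟨ +-monoʳ-≤ n (+-mono-≤ (∸-monoˡ-≤ 1 2≤fk) (∸-monoˡ-≤ 1 2≤fk')) ⟩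
    n + (pred (f k) + pred (f k'))      ≤⟨ +-monoʳ-≤ n (lookup+lookup≤sum-tabulate (pred ∘ f) k≢k') ⟩
    n + sum (tabulate (pred ∘ f))       ≡⟨ sum-tabulate≡n+sum-tabulate-pred f 1≤f ⟨
    sum (tabulate f)                    ∎
    where open ≤-Reasoning

sum-map-cartesianProduct : ∀ {A B : Set} (g : A × B → ℕ) (xs : List A) (ys : List B) →
  sum (map g (cartesianProduct xs ys)) ≡ sum (map (λ x → sum (map (λ y → g (x , y)) ys)) xs)
sum-map-cartesianProduct g []       ys = refl
sum-map-cartesianProduct g (x ∷ xs) ys = begin
  sum (map g (map (x ,_) ys ++ cartesianProduct xs ys))
    ≡⟨ cong sum (map-++ g (map (x ,_) ys) (cartesianProduct xs ys)) ⟩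
  sum (map g (map (x ,_) ys) ++ map g (cartesianProduct xs ys))
    ≡⟨ sum-++ (map g (map (x ,_) ys)) (map g (cartesianProduct xs ys)) ⟩
  sum (map g (map (x ,_) ys)) + sum (map g (cartesianProduct xs ys))
    ≡⟨ cong₂ _+_ (cong sum (sym (map-∘ ys))) (sum-map-cartesianProduct g xs ys) ⟩
  sum (map (λ y → g (x , y)) ys) + sum (map (λ x → sum (map (λ y → g (x , y)) ys)) xs) ∎
  where open ≡-Reasoning

rowCount : ∀ {h ℓ} → VSet h ℓ → Fin h → ℕ
rowCount X i = sum (tabulate λ j → if X (i , j) then 1 else 0)

card≡sum-rowCount : ∀ {h ℓ} (X : VSet h ℓ) → card X ≡ sum (tabulate (rowCount X))
card≡sum-rowCount {h} {ℓ} X = begin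
  card X
    ≡⟨ sum-map-cartesianProduct indicator (allFin h) (allFin ℓ) ⟩
  sum (map (λ i → sum (map (λ j → indicator (i , j)) (allFin ℓ))) (allFin h))
    ≡⟨ cong sum (map-tabulate (λ i → i) (λ i → sum (map (λ j → indicator (i , j)) (allFin ℓ)))) ⟩
  sum (tabulate (λ i → sum (map (λ j → indicator (i , j)) (allFin ℓ))))
    ≡⟨ cong sum (tabulate-cong (λ i → cong sum (map-tabulate (λ j → j) (λ j → indicator (i , j))))) ⟩
  sum (tabulate (rowCount X)) ∎
  where
  open ≡-Reasoning
  indicator : Vertex h ℓ → ℕ
  indicator v = if X v then 1 else 0

module _ {h ℓ} (X : VSet h ℓ) (r : Fin h) where

  ∈⇒1≤rowCount : ∀ {j} → X (r , j) ≡ true → 1 ≤ rowCount X r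
  ∈⇒1≤rowCount {j} j∈X =
    subst (λ b → (if b then 1 else 0) ≤ rowCount X r) j∈X (lookup≤sum-tabulate _ j)

  two∈⇒2≤rowCount : ∀ {j j'} → j ≢ j' → X (r , j) ≡ true → X (r , j') ≡ true → 2 ≤ rowCount X r
  two∈⇒2≤rowCount j≢j' j∈X j'∈X =
    subst (λ n → n ≤ rowCount X r)
          (cong₂ (λ b b' → (if b then 1 else 0) + (if b' then 1 else 0)) j∈X j'∈X)
          (lookup+lookup≤sum-tabulate _ j≢j')

Between : ℕ → ℕ → ℕ → Set
Between p q j = (p ≤ j × j ≤ q) ⊎ (q ≤ j × j ≤ p)

between? : ∀ p q j → Dec (Between p q j)
between? p q j = ((p ≤? j) ×-dec (j ≤? q)) ⊎-dec ((q ≤? j) ×-dec (j ≤? p))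

¬between-all-pairs : ∀ {a b c j} → Between a b j → Between c a j → Between c b j →
  j ≢ a → j ≢ b → j ≢ c → ⊥
¬between-all-pairs (inj₁ (a≤j , _))  (inj₁ (_ , j≤a))  _                 j≢a _   _   = j≢a (≤-antisym j≤a a≤j)
¬between-all-pairs (inj₁ _)          (inj₂ (_ , j≤c))  (inj₁ (c≤j , _))  _   _   j≢c = j≢c (≤-antisym j≤c c≤j)
¬between-all-pairs (inj₁ (_ , j≤b))  (inj₂ _)          (inj₂ (b≤j , _))  _   j≢b _   = j≢b (≤-antisym j≤b b≤j)
¬between-all-pairs (inj₂ (_ , j≤a))  (inj₂ (a≤j , _))  _                 j≢a _   _   = j≢a (≤-antisym j≤a a≤j)
¬between-all-pairs (inj₂ (b≤j , _))  (inj₁ _)          (inj₁ (_ , j≤b))  _   j≢b _   = j≢b (≤-antisym j≤b b≤j)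
¬between-all-pairs (inj₂ _)          (inj₁ (c≤j , _))  (inj₂ (_ , j≤c))  _   _   j≢c = j≢c (≤-antisym j≤c c≤j)

∣n-1+n∣≡1 : ∀ n → ∣ n - suc n ∣ ≡ 1
∣n-1+n∣≡1 zero    = refl
∣n-1+n∣≡1 (suc n) = ∣n-1+n∣≡1 n

module _ {h ℓ : ℕ} where

  adj-sym : {x y : Vertex h ℓ} → Adj x y → Adj y x
  adj-sym {i , j} {i' , j'} x-y = trans (cong₂ _+_ (∣-∣-comm (toℕ i') (toℕ i)) (∣-∣-comm (toℕ j') (toℕ j))) x-y

  adj-horizontal : (r : Fin h) {p q : Fin ℓ} → toℕ q ≡ suc (toℕ p) → Adj (r , p) (r , q)
  adj-horizontal r {p} q≡1+p =
    trans (cong₂ _+_ (∣n-n∣≡0 (toℕ r)) (cong (∣ toℕ p -_∣) q≡1+p)) (∣n-1+n∣≡1 (toℕ p))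

  adj-vertical : {r s : Fin h} (c : Fin ℓ) → ∣ toℕ r - toℕ s ∣ ≡ 1 → Adj (r , c) (s , c)
  adj-vertical c r-s = trans (cong (_+ ∣ toℕ c - toℕ c ∣) r-s) (cong suc (∣n-n∣≡0 (toℕ c)))

∣-∣≡1⇒≢ : ∀ {n} {r s : Fin n} → ∣ toℕ r - toℕ s ∣ ≡ 1 → r ≢ s
∣-∣≡1⇒≢ {r = r} r-s refl = contradiction (trans (sym (∣n-n∣≡0 (toℕ r))) r-s) λ ()

adjacent-row : ∀ {h} → 2 ≤ h → (r : Fin h) → ∃ λ (s : Fin h) → ∣ toℕ r - toℕ s ∣ ≡ 1
adjacent-row (s≤s (s≤s _)) zero    = suc zero , refl
adjacent-row (s≤s (s≤s _)) (suc k) =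
  inject₁ k , trans (cong (∣ suc (toℕ k) -_∣) (Fin.toℕ-inject₁ k))
                    (trans (∣-∣-comm (suc (toℕ k)) (toℕ k)) (∣n-1+n∣≡1 (toℕ k)))

module Connectivity {h ℓ} (X : VSet h ℓ) where

  step-sym : ∀ {x y} → Step X x y → Step X y x
  step-sym {x} {y} (x∉X , y∉X , x-y) = y∉X , x∉X , adj-sym {x = x} {y} x-y

  connected-sym : ∀ {x y} → Connected X x y → Connected X y x
  connected-sym (x∉X , y∉X , path) = y∉X , x∉X , reverse step-sym path

  connected-trans : ∀ {x y z} → Connected X x y → Connected X y z → Connected X x z
  connected-trans (x∉X , _ , path) (_ , z∉X , path') = x∉X , z∉X , path ◅◅ path'

  connected-adj : ∀ {x y} → NotIn X x → NotIn X y → Adj x y → Connected X x y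
  connected-adj x∉X y∉X x-y = x∉X , y∉X , (x∉X , y∉X , x-y) ◅ ε

  column≢ : ∀ {r j c} → X (r , j) ≡ true → NotIn X (r , c) → toℕ j ≢ toℕ c
  column≢ j∈X c∉X j≡c with refl ← Fin.toℕ-injective j≡c = contradiction (trans (sym j∈X) c∉X) λ ()

  rightward-path : (r : Fin h) (k : ℕ) {p q : Fin ℓ} → toℕ q ≡ k + toℕ p →
    (∀ j → toℕ p ≤ toℕ j → toℕ j ≤ toℕ q → NotIn X (r , j)) → Star (Step X) (r , p) (r , q)
  rightward-path r zero    q≡p _ with refl ← Fin.toℕ-injective q≡p = ε
  rightward-path r (suc k) {p} {q} q≡1+k+p free =
    (free p ≤-refl p≤q , free p' p≤p' p'≤q , adj-horizontal r p'≡1+p)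
    ◅ rightward-path r k q≡k+p' (λ j p'≤j → free j (≤-trans p≤p' p'≤j))
    where
    1+p≤q : suc (toℕ p) ≤ toℕ q
    1+p≤q = subst (suc (toℕ p) ≤_) (sym q≡1+k+p) (s≤s (m≤n+m (toℕ p) k))
    p≤q : toℕ p ≤ toℕ q
    p≤q = ≤-trans (n≤1+n (toℕ p)) 1+p≤q
    1+p<ℓ : suc (toℕ p) < ℓ
    1+p<ℓ = ≤-<-trans 1+p≤q (Fin.toℕ<n q)
    p' : Fin ℓ
    p' = fromℕ< 1+p<ℓ
    p'≡1+p : toℕ p' ≡ suc (toℕ p)
    p'≡1+p = Fin.toℕ-fromℕ< 1+p<ℓ
    p≤p' : toℕ p ≤ toℕ p'
    p≤p' = subst (toℕ p ≤_) (sym p'≡1+p) (n≤1+n (toℕ p))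
    p'≤q : toℕ p' ≤ toℕ q
    p'≤q = subst (_≤ toℕ q) (sym p'≡1+p) 1+p≤q
    q≡k+p' : toℕ q ≡ k + toℕ p'
    q≡k+p' = trans q≡1+k+p (trans (sym (+-suc k (toℕ p))) (cong (k +_) (sym p'≡1+p)))

  segment-path : (r : Fin h) (p q : Fin ℓ) →
    (∀ j → Between (toℕ p) (toℕ q) (toℕ j) → NotIn X (r , j)) → Star (Step X) (r , p) (r , q)
  segment-path r p q free with ≤-total (toℕ p) (toℕ q)
  ... | inj₁ p≤q = rightward-path r (toℕ q ∸ toℕ p) (sym (m∸n+n≡m p≤q))
                     (λ j p≤j j≤q → free j (inj₁ (p≤j , j≤q)))
  ... | inj₂ q≤p = reverse step-sym (rightward-path r (toℕ p ∸ toℕ q) (sym (m∸n+n≡m q≤p))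
                     (λ j q≤j j≤p → free j (inj₂ (q≤j , j≤p))))

  row-blocked : ∀ {r p q} → NotIn X (r , p) → NotIn X (r , q) → ¬ Connected X (r , p) (r , q) →
    ∃ λ j → Between (toℕ p) (toℕ q) (toℕ j) × X (r , j) ≡ true
  row-blocked {r} {p} {q} p∉X q∉X p≁q
    with Fin.any? (λ j → between? (toℕ p) (toℕ q) (toℕ j) ×-dec (X (r , j) Bool.≟ true))
  ... | yes blocker = blocker
  ... | no ¬blocker = contradiction (p∉X , q∉X , segment-path r p q free) p≁q
    where
    free : ∀ j → Between (toℕ p) (toℕ q) (toℕ j) → NotIn X (r , j)
    free j between = Bool.¬-not (λ j∈X → ¬blocker (j , between , j∈X))

module TwoGoodComponents {h ℓ} (X : VSet h ℓ) (bound : card X ≤ h + 1) (u v : Vertex h ℓ) {a b : Fin ℓ}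
  (u~a : ∀ i → Connected X u (i , a)) (v~b : ∀ i → Connected X v (i , b)) (u≁v : ¬ Connected X u v)
  where

  open Connectivity X

  Stranded : Vertex h ℓ → Set
  Stranded w = NotIn X w × ¬ Connected X u w × ¬ Connected X v w

  a∉X : ∀ i → NotIn X (i , a)
  a∉X i = let _ , a∉X , _ = u~a i in a∉X

  b∉X : ∀ i → NotIn X (i , b)
  b∉X i = let _ , b∉X , _ = v~b i in b∉X

  separator : ∀ i → ∃ λ j → Between (toℕ a) (toℕ b) (toℕ j) × X (i , j) ≡ true
  separator i = row-blocked (a∉X i) (b∉X i)
    (λ a~b → u≁v (connected-trans (u~a i) (connected-trans a~b (connected-sym (v~b i)))))

  heavy-row-unique : ∀ {r s} → 2 ≤ rowCount X r → 2 ≤ rowCount X s → r ≡ s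
  heavy-row-unique = ≥2-unique (rowCount X) (λ i → let _ , _ , j∈X = separator i in ∈⇒1≤rowCount X i j∈X)
                       (subst (_≤ h + 1) (card≡sum-rowCount X) bound)

  stranded-step : ∀ {w w'} → Stranded w → NotIn X w' → Adj w w' → Stranded w'
  stranded-step {w} {w'} (w∉X , u≁w , v≁w) w'∉X w-w' =
      w'∉X
    , (λ u~w' → u≁w (connected-trans u~w' w'~w))
    , (λ v~w' → v≁w (connected-trans v~w' w'~w))
    where
    w'~w : Connected X w' w
    w'~w = connected-adj w'∉X w∉X (adj-sym {x = w} {w'} w-w')

  stranded⇒2≤rowCount : ∀ {r c} → Stranded (r , c) → 2 ≤ rowCount X r
  stranded⇒2≤rowCount {r} {c} (c∉X , u≁c , v≁c)
    with j₁ , c-j₁-a , j₁∈X ← row-blocked c∉X (a∉X r) (λ c~a → u≁c (connected-trans (u~a r) (connected-sym c~a)))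
       | j₂ , c-j₂-b , j₂∈X ← row-blocked c∉X (b∉X r) (λ c~b → v≁c (connected-trans (v~b r) (connected-sym c~b)))
       | j₃ , a-j₃-b , j₃∈X ← separator r
    with j₁ Fin.≟ j₂ | j₁ Fin.≟ j₃
  ... | no j₁≢j₂ | _        = two∈⇒2≤rowCount X r j₁≢j₂ j₁∈X j₂∈X
  ... | yes _    | no j₁≢j₃ = two∈⇒2≤rowCount X r j₁≢j₃ j₁∈X j₃∈X
  ... | yes refl | yes refl = contradiction a-j₃-b λ a-j₁-b →
    ¬between-all-pairs a-j₁-b c-j₁-a c-j₂-b (column≢ j₁∈X (a∉X r)) (column≢ j₁∈X (b∉X r)) (column≢ j₁∈X c∉X)

  stranded⇒adjacent∈X : ∀ {r s c} → ∣ toℕ r - toℕ s ∣ ≡ 1 → Stranded (r , c) → X (s , c) ≡ true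
  stranded⇒adjacent∈X {r} {s} {c} r-s stranded with X (s , c) in sc∉X
  ... | true  = refl
  ... | false = contradiction (heavy-row-unique (stranded⇒2≤rowCount stranded)
                   (stranded⇒2≤rowCount (stranded-step stranded sc∉X (adj-vertical {r = r} {s} c r-s))))
                 (∣-∣≡1⇒≢ r-s)

  stranded-unique : 2 ≤ h → ∀ {w w'} → Stranded w → Stranded w' → w ≡ w'
  stranded-unique 2≤h {r , c} {r' , c'} w w'
    with refl ← heavy-row-unique (stranded⇒2≤rowCount w) (stranded⇒2≤rowCount w')
    with c Fin.≟ c' | adjacent-row 2≤h r
  ... | yes refl  | _       = refl
  ... | no c≢c'   | s , r-s =
    contradiction (heavy-row-unique (stranded⇒2≤rowCount w)
                    (two∈⇒2≤rowCount X s c≢c' (stranded⇒adjacent∈X r-s w) (stranded⇒adjacent∈X r-s w')))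
                  (∣-∣≡1⇒≢ r-s)

lemma35 : (h ℓ : ℕ) → 2 ≤ h → 2 ≤ ℓ → (X : VSet h ℓ) → card X ≤ h + 1 →
    (u v : Vertex h ℓ) → NotIn X u → NotIn X v →
    GoodComponentOf X u → GoodComponentOf X v → ¬ Connected X u v →
    (∀ (w w' : Vertex h ℓ) → NotIn X w → NotIn X w' →
      ¬ Connected X u w → ¬ Connected X v w →
      ¬ Connected X u w' → ¬ Connected X v w' →
      w ≡ w')
lemma35 _ _ 2≤h _ X bound u v _ _ (a , u~a) (b , v~b) u≁v w w' w∉X w'∉X u≁w v≁w u≁w' v≁w' =
  stranded-unique 2≤h (w∉X , u≁w , v≁w) (w'∉X , u≁w' , v≁w')
  where open TwoGoodComponents X bound u v u~a v~b u≁v
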